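{- Let $A\subseteq[n]$ and let $\mathcal C\subseteq\mathbb R^n$ be a cone generated by $l$ extremal rays $\{r_1,\dots,r_l\}\subseteq R_A$, where $\dim(\mathcal C)<n$. Then there exists a vector $\tilde r\in R_A$ such that $\dim(\mathrm{cone}\{r_1,\dots,r_l,\tilde r\})=\dim(\mathcal C)+1$ and the vectors $r_1,\dots,r_l,\tilde r$ are all extremal rays of $\mathrm{cone}\{r_1,\dots,r_l,\tilde r\}$.
   Context: $e_i$ denotes the $i$-th standard unit vector of $\mathbb R^n$. For $A\subseteq[n]$ the elementary set of $A$ is $R_A=\{e_i-e_j,\ e_i,\ -e_j : i\in[n],\ j\in A\}$.
   Formalization: The cones are taken over ℚ rather than ℝ, so their dimension is a rank over ℚ and extremality of rays is tested only against rational vectors of the cone. -}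

module Defs where

open import Data.Nat using (ℕ; zero; suc)
open import Data.Fin using (Fin; zero; suc)
open import Data.Fin.Subset using (Subset; _∈_)
open import Data.Rational using (ℚ; 0ℚ; 1ℚ; _+_; _*_; -_; _≤_)
open import Data.Product using (Σ; ∃; ∃-syntax; _×_; _,_)
open import Data.Sum using (_⊎_)
open import Relation.Nullary using (¬_)
open import Relation.Binary.PropositionalEquality using (_≡_; _≢_)
open import Data.Vec.Functional using (Vector) renaming (_∷_ to _∷ᵥ_)

Vec : ℕ → Set
Vec n = Fin n → ℚ

_≈_ : ∀ {n} → Vec n → Vec n → Set
_≈_ {n} v w = ∀ (k : Fin n) → v k ≡ w k

0v : ∀ {n} → Vec n
0v _ = 0ℚ

_+v_ : ∀ {n} → Vec n → Vec n → Vec n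
(v +v w) k = v k + w k

_·_ : ∀ {n} → ℚ → Vec n → Vec n
(a · v) k = a * v k

negv : ∀ {n} → Vec n → Vec n
negv v k = - v k

e : ∀ {n} → Fin n → Vec n
e zero    zero    = 1ℚ
e zero    (suc _) = 0ℚ
e (suc i) zero    = 0ℚ
e (suc i) (suc k) = e i k

lincomb : ∀ {n} (m : ℕ) → (Fin m → ℚ) → (Fin m → Vec n) → Vec n
lincomb zero    c v = 0v
lincomb (suc m) c v = (c zero · v zero) +v lincomb m (λ i → c (suc i)) (λ i → v (suc i))

InR : ∀ {n} → Subset n → Vec n → Set
InR {n} A v =
    (Σ (Fin n) λ i → Σ (Fin n) λ j → (j ∈ A) × (v ≈ (e i +v negv (e j))))
  ⊎ (Σ (Fin n) λ i → v ≈ e i)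
  ⊎ (Σ (Fin n) λ j → (j ∈ A) × (v ≈ negv (e j)))

InCone : ∀ {n} (m : ℕ) → (Fin m → Vec n) → Vec n → Set
InCone {n} m gens x =
  Σ (Fin m → ℚ) λ c → (∀ i → 0ℚ ≤ c i) × (x ≈ lincomb m c gens)

LinIndep : ∀ {n} (k : ℕ) → (Fin k → Vec n) → Set
LinIndep k v = ∀ (c : Fin k → ℚ) → lincomb k c v ≈ 0v → ∀ i → c i ≡ 0ℚ

-- dimension of a set C ∋ 0 (a cone): dimension of its linear span,
-- i.e. the maximal number of linearly independent vectors in C
HasDim : ∀ {n} → (Vec n → Set) → ℕ → Set
HasDim {n} C d =
    (Σ (Fin d → Vec n) λ v → (∀ i → C (v i)) × LinIndep d v)
  × (∀ (w : Fin (suc d) → Vec n) → (∀ i → C (w i)) → ¬ LinIndep (suc d) w)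

IsExtremalRay : ∀ {n} → (Vec n → Set) → Vec n → Set
IsExtremalRay {n} C r =
    C r
  × ¬ (r ≈ 0v)
  × (∀ (x y : Vec n) → C x → C y → (x +v y) ≈ r →
       (Σ ℚ λ a → (0ℚ ≤ a) × (x ≈ (a · r)))
     × (Σ ℚ λ b → (0ℚ ≤ b) × (y ≈ (b · r))))

cons : ∀ {n} {l : ℕ} → Vec n → (Fin l → Vec n) → Fin (suc l) → Vec n
cons r gens zero    = r
cons r gens (suc i) = gens i

module Submission where

-- Let C = cone(r₁,…,r_l) ⊆ ℚⁿ have dimension d < n, witnessed by independent
-- vectors b₁,…,b_d of C.  We take r̃ = e_i, a unit vector outside span(b);
-- unit vectors belong to R_A whatever A is.  Hence dim C' = d + 1, and with pointedness e_i and all r_j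
--     are extremal rays of C'.

open import Defs
open import Data.Nat using (ℕ; suc; _<_)
open import Data.Fin using (Fin)
open import Data.Fin.Subset using (Subset)
open import Data.Product using (Σ; _×_)
open import Relation.Binary.PropositionalEquality using (_≡_)

open import Algebra.Bundles using (Ring)
open import Data.Nat as ℕ using (zero; z≤n; s≤s)
import Data.Nat.Properties as ℕₚ
open import Data.Fin using (zero; suc; punchIn; punchOut; _≟_)
open import Data.Fin.Properties using (any?; all?; ¬∀⟶∃¬)
open import Data.Rational using (ℚ; 0ℚ; 1ℚ; _+_; _*_; -_; _-_; 1/_; _≤_; NonZero; ≢-nonZero)
import Data.Rational.Properties as ℚₚ
open import Data.Rational.Solver using (module +-*-Solver)
open import Data.Product as Prod using (_,_; proj₁; proj₂; ∃)
open import Data.Sum as Sum using (_⊎_; inj₁; inj₂)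
open import Data.Vec.Functional using (_∷_; insertAt; removeAt)
open import Data.Vec.Functional.Properties using (insertAt-lookup; insertAt-punchIn; removeAt-punchOut)
open import Data.Empty using (⊥-elim)
open import Function using (_∘_)
open import Relation.Nullary using (¬_; Dec; yes; no)
open import Relation.Binary.PropositionalEquality
  using (_≢_; refl; sym; trans; cong; cong₂; subst; module ≡-Reasoning)
open import Algebra.Properties.Semiring.Sum (Ring.semiring ℚₚ.+-*-ring)
  using (sum-syntax; sum-cong-≗; sum-replicate-zero; sum-remove; ∑-distrib-+; ∑-comm; *-distribˡ-sum; *-distribʳ-sum)
open import Algebra.Properties.Group (Ring.+-group ℚₚ.+-*-ring)
  using (inverseʳ-unique; x∙y⁻¹≈ε⇒x≈y)
open +-*-Solver using (solve; _:+_; _:-_; _:*_; :-_; con; _:=_)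
open ≡-Reasoning

cancel-nonzero : ∀ a b → a * b ≡ 0ℚ → a ≢ 0ℚ → b ≡ 0ℚ
cancel-nonzero a b ab≡0 a≢0 = begin
  b                ≡⟨ sym (ℚₚ.*-identityˡ b) ⟩
  1ℚ * b           ≡⟨ cong (_* b) (sym (ℚₚ.*-inverseˡ a)) ⟩
  (1/ a) * a * b   ≡⟨ ℚₚ.*-assoc (1/ a) a b ⟩
  (1/ a) * (a * b) ≡⟨ cong ((1/ a) *_) ab≡0 ⟩
  (1/ a) * 0ℚ      ≡⟨ ℚₚ.*-zeroʳ (1/ a) ⟩
  0ℚ               ∎
  where
    instance
      a-nonZero : NonZero a
      a-nonZero = ≢-nonZero a≢0

nonneg-sum-zero : ∀ {a b} → 0ℚ ≤ a → 0ℚ ≤ b → a + b ≡ 0ℚ → a ≡ 0ℚ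
nonneg-sum-zero {a} {b} a≥0 b≥0 a+b≡0 = ℚₚ.≤-antisym a≤0 a≥0
  where
    a≤0 : a ≤ 0ℚ
    a≤0 = subst (a ≤_) a+b≡0 (subst (_≤ a + b) (ℚₚ.+-identityʳ a) (ℚₚ.+-monoʳ-≤ a b≥0))

scalar-annihilates : ∀ {n} s (v : Vec n) → (∀ k → s * v k ≡ 0ℚ) → ¬ (v ≈ 0v) → s ≡ 0ℚ
scalar-annihilates s v sv≡0 v≢0 with s ℚₚ.≟ 0ℚ
... | yes s≡0 = s≡0
... | no s≢0 = ⊥-elim (v≢0 (λ k → cancel-nonzero s (v k) (sv≡0 k) s≢0))

∑-zero : ∀ m {f : Fin m → ℚ} → (∀ j → f j ≡ 0ℚ) → ∑[ j < m ] f j ≡ 0ℚ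
∑-zero m f≡0 = trans (sum-cong-≗ f≡0) (sum-replicate-zero m)

∑-sub : ∀ m (f g : Fin m → ℚ) → ∑[ j < m ] (f j - g j) ≡ ∑[ j < m ] f j - ∑[ j < m ] g j
∑-sub zero    f g = refl
∑-sub (suc m) f g = begin
  (f zero - g zero) + ∑[ j < m ] (f (suc j) - g (suc j))
    ≡⟨ cong ((f zero - g zero) +_) (∑-sub m (f ∘ suc) (g ∘ suc)) ⟩
  (f zero - g zero) + (∑[ j < m ] f (suc j) - ∑[ j < m ] g (suc j))
    ≡⟨ solve 4 (λ a b c d → (a :- b) :+ (c :- d) := (a :+ c) :- (b :+ d)) refl (f zero) (g zero) _ _ ⟩
  (f zero + ∑[ j < m ] f (suc j)) - (g zero + ∑[ j < m ] g (suc j)) ∎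

lincomb-coord : ∀ {n} m c (v : Fin m → Vec n) k → lincomb m c v k ≡ ∑[ j < m ] (c j * v j k)
lincomb-coord zero    c v k = refl
lincomb-coord (suc m) c v k = cong (c zero * v zero k +_) (lincomb-coord m (c ∘ suc) (v ∘ suc) k)

∑-unit : ∀ n (c : Fin n → ℚ) (k : Fin n) → ∑[ j < n ] (c j * e j k) ≡ c k
∑-unit (suc n) c zero = begin
  c zero * 1ℚ + ∑[ j < n ] (c (suc j) * 0ℚ) ≡⟨ cong (c zero * 1ℚ +_) (∑-zero n (λ j → ℚₚ.*-zeroʳ (c (suc j)))) ⟩
  c zero * 1ℚ + 0ℚ                          ≡⟨ ℚₚ.+-identityʳ _ ⟩
  c zero * 1ℚ                               ≡⟨ ℚₚ.*-identityʳ _ ⟩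
  c zero                                    ∎
∑-unit (suc n) c (suc k) = begin
  c zero * 0ℚ + ∑[ j < n ] (c (suc j) * e j k) ≡⟨ cong₂ _+_ (ℚₚ.*-zeroʳ (c zero)) (∑-unit n (c ∘ suc) k) ⟩
  0ℚ + c (suc k)                               ≡⟨ ℚₚ.+-identityˡ _ ⟩
  c (suc k)                                    ∎

unit-diagonal : ∀ {n} (i : Fin n) → e i i ≡ 1ℚ
unit-diagonal zero    = refl
unit-diagonal (suc i) = unit-diagonal i

IsRelation : ∀ {n} m → (Fin m → ℚ) → (Fin m → Vec n) → Set
IsRelation {n} m c v = ∀ (k : Fin n) → ∑[ j < m ] (c j * v j k) ≡ 0ℚ

Dependent : ∀ {n} m → (Fin m → Vec n) → Set
Dependent m v = Σ (Fin m → ℚ) λ c → IsRelation m c v × ∃ λ q → c q ≢ 0ℚ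

Independent : ∀ {n} m → (Fin m → Vec n) → Set
Independent m v = ∀ c → IsRelation m c v → ∀ i → c i ≡ 0ℚ

InSpan : ∀ {n} k → (Fin k → Vec n) → Vec n → Set
InSpan {n} k g x = Σ (Fin k → ℚ) λ β → ∀ (i : Fin n) → x i ≡ ∑[ t < k ] (β t * g t i)

independent⇒LinIndep : ∀ {n} m (v : Fin m → Vec n) → Independent m v → LinIndep m v
independent⇒LinIndep m v indep c c·v≈0 = indep c (λ k → trans (sym (lincomb-coord m c v k)) (c·v≈0 k))

LinIndep⇒independent : ∀ {n} m (v : Fin m → Vec n) → LinIndep m v → Independent m v
LinIndep⇒independent m v indep c rel = indep c (λ k → trans (lincomb-coord m c v k) (rel k))

dependent⇒¬independent : ∀ {n} m (v : Fin m → Vec n) → Dependent m v → ¬ Independent m v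
dependent⇒¬independent m v (c , rel , q , cq≢0) indep = cq≢0 (indep c rel q)

units-independent : ∀ n → Independent n (e {n})
units-independent n c rel i = trans (sym (∑-unit n c i)) (rel i)

-- One step of Gaussian elimination.
module Pivot {n m : ℕ} (v : Fin (suc m) → Vec (suc n)) (p : Fin (suc m)) (pivot≢0 : v p zero ≢ 0ℚ) where

  private
    pivot : ℚ
    pivot = v p zero

    instance
      pivot-nonZero : NonZero pivot
      pivot-nonZero = ≢-nonZero pivot≢0

  others : Fin m → Vec (suc n)
  others j = v (punchIn p j)

  multiplier : Fin m → ℚ
  multiplier j = others j zero * 1/ pivot

  reduced : Fin m → Vec n
  reduced j k = others j (suc k) - multiplier j * v p (suc k)

  clears-first : ∀ j → others j zero - multiplier j * pivot ≡ 0ℚ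
  clears-first j = begin
    x - x * 1/ pivot * pivot   ≡⟨ cong (λ z → x - z) (ℚₚ.*-assoc x (1/ pivot) pivot) ⟩
    x - x * (1/ pivot * pivot) ≡⟨ cong (λ z → x - x * z) (ℚₚ.*-inverseˡ pivot) ⟩
    x - x * 1ℚ                 ≡⟨ solve 1 (λ x → x :- x :* con 1ℚ := con 0ℚ) refl x ⟩
    0ℚ                         ∎
    where
      x : ℚ
      x = others j zero

  split-pivot : ∀ (c : Fin (suc m) → ℚ) k →
    ∑[ j < suc m ] (c j * v j k) ≡ c p * v p k + ∑[ j < m ] (removeAt c p j * others j k)
  split-pivot c k = sum-remove (λ j → c j * v j k)

  ∑-eliminate : ∀ (c : Fin m → ℚ) k →
    ∑[ j < m ] (c j * (others j k - multiplier j * v p k))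
      ≡ ∑[ j < m ] (c j * others j k) - ∑[ j < m ] (c j * multiplier j) * v p k
  ∑-eliminate c k = begin
    ∑[ j < m ] (c j * (others j k - multiplier j * v p k))
      ≡⟨ sum-cong-≗ (λ j → solve 4 (λ c x t y → c :* (x :- t :* y) := c :* x :- c :* t :* y) refl (c j) (others j k) (multiplier j) (v p k)) ⟩
    ∑[ j < m ] (c j * others j k - c j * multiplier j * v p k)
      ≡⟨ ∑-sub m _ _ ⟩
    ∑[ j < m ] (c j * others j k) - ∑[ j < m ] (c j * multiplier j * v p k)
      ≡⟨ cong (λ z → ∑[ j < m ] (c j * others j k) - z) (sym (*-distribʳ-sum (v p k) (λ j → c j * multiplier j))) ⟩
    ∑[ j < m ] (c j * others j k) - ∑[ j < m ] (c j * multiplier j) * v p k ∎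

  -- A nontrivial relation c among the reduced vectors lifts to v, giving the
  -- pivot the coefficient −Σ_j c_j · multiplier_j.
  lift-dependence : Dependent m reduced → Dependent (suc m) v
  lift-dependence (c , rel , q , cq≢0) = c⁺ , rel⁺ , punchIn p q , c⁺≢0
    where
      T : ℚ
      T = ∑[ j < m ] (c j * multiplier j)
      c⁺ : Fin (suc m) → ℚ
      c⁺ = insertAt c p (- T)
      c⁺≢0 : c⁺ (punchIn p q) ≢ 0ℚ
      c⁺≢0 eq = cq≢0 (trans (sym (insertAt-punchIn c p (- T) q)) eq)
      vanishes : ∀ k → ∑[ j < m ] (c j * (others j k - multiplier j * v p k)) ≡ 0ℚ
      vanishes zero    = ∑-zero m (λ j → trans (cong (c j *_) (clears-first j)) (ℚₚ.*-zeroʳ (c j)))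
      vanishes (suc k) = rel k
      rel⁺ : IsRelation (suc m) c⁺ v
      rel⁺ k = begin
        ∑[ j < suc m ] (c⁺ j * v j k)
          ≡⟨ split-pivot c⁺ k ⟩
        c⁺ p * v p k + ∑[ j < m ] (c⁺ (punchIn p j) * others j k)
          ≡⟨ cong₂ (λ a s → a * v p k + s) (insertAt-lookup c p (- T))
                   (sum-cong-≗ (λ j → cong (_* others j k) (insertAt-punchIn c p (- T) j))) ⟩
        - T * v p k + ∑[ j < m ] (c j * others j k)
          ≡⟨ solve 3 (λ T y s → (:- T) :* y :+ s := s :- T :* y) refl T (v p k) _ ⟩
        ∑[ j < m ] (c j * others j k) - T * v p k
          ≡⟨ sym (∑-eliminate c k) ⟩
        ∑[ j < m ] (c j * (others j k - multiplier j * v p k))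
          ≡⟨ vanishes k ⟩
        0ℚ ∎

  expanded : ∀ c → IsRelation (suc m) c v → ∀ k →
    c p * v p k + ∑[ j < m ] (removeAt c p j * others j k) ≡ 0ℚ
  expanded c rel k = trans (sym (split-pivot c k)) (rel k)

  -- Dropping the pivot coefficient turns a relation among v into a relation
  -- among the reduced vectors: the first coordinate fixes Σ_j c_j·multiplier_j.
  restrict-relation : ∀ c → IsRelation (suc m) c v → IsRelation m (removeAt c p) reduced
  restrict-relation c rel k = begin
    ∑[ j < m ] (c' j * (others j (suc k) - multiplier j * v p (suc k)))
      ≡⟨ ∑-eliminate c' (suc k) ⟩
    ∑[ j < m ] (c' j * others j (suc k)) - ∑[ j < m ] (c' j * multiplier j) * v p (suc k)
      ≡⟨ cong (λ w → ∑[ j < m ] (c' j * others j (suc k)) - w * v p (suc k)) weight ⟩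
    ∑[ j < m ] (c' j * others j (suc k)) - (- c p) * v p (suc k)
      ≡⟨ solve 3 (λ s x y → s :- (:- x) :* y := x :* y :+ s) refl _ (c p) (v p (suc k)) ⟩
    c p * v p (suc k) + ∑[ j < m ] (c' j * others j (suc k))
      ≡⟨ expanded c rel (suc k) ⟩
    0ℚ ∎
    where
      c' : Fin m → ℚ
      c' = removeAt c p
      weight : ∑[ j < m ] (c' j * multiplier j) ≡ - c p
      weight = begin
        ∑[ j < m ] (c' j * (others j zero * 1/ pivot))
          ≡⟨ sum-cong-≗ (λ j → sym (ℚₚ.*-assoc (c' j) _ (1/ pivot))) ⟩
        ∑[ j < m ] (c' j * others j zero * 1/ pivot)
          ≡⟨ sym (*-distribʳ-sum (1/ pivot) (λ j → c' j * others j zero)) ⟩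
        ∑[ j < m ] (c' j * others j zero) * 1/ pivot
          ≡⟨ cong (_* 1/ pivot) (inverseʳ-unique (c p * pivot) _ (expanded c rel zero)) ⟩
        - (c p * pivot) * 1/ pivot
          ≡⟨ solve 3 (λ x a ia → (:- (x :* a)) :* ia := :- (x :* (ia :* a))) refl (c p) pivot (1/ pivot) ⟩
        - (c p * (1/ pivot * pivot))
          ≡⟨ cong (λ z → - (c p * z)) (ℚₚ.*-inverseˡ pivot) ⟩
        - (c p * 1ℚ)
          ≡⟨ cong -_ (ℚₚ.*-identityʳ (c p)) ⟩
        - c p ∎

  pivot-coefficient : ∀ c → IsRelation (suc m) c v → (∀ j → removeAt c p j ≡ 0ℚ) → c p ≡ 0ℚ
  pivot-coefficient c rel c'≡0 = cancel-nonzero pivot (c p) pivot·c≡0 pivot≢0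
    where
      others-vanish : ∀ j → removeAt c p j * others j zero ≡ 0ℚ
      others-vanish j = trans (cong (_* others j zero) (c'≡0 j)) (ℚₚ.*-zeroˡ (others j zero))
      pivot·c≡0 : pivot * c p ≡ 0ℚ
      pivot·c≡0 = begin
        pivot * c p                                                ≡⟨ ℚₚ.*-comm pivot (c p) ⟩
        c p * pivot                                                ≡⟨ sym (ℚₚ.+-identityʳ _) ⟩
        c p * pivot + 0ℚ                                           ≡⟨ cong (c p * pivot +_) (sym (∑-zero m others-vanish)) ⟩
        c p * pivot + ∑[ j < m ] (removeAt c p j * others j zero) ≡⟨ expanded c rel zero ⟩
        0ℚ                                                         ∎

  lift-independence : Independent m reduced → Independent (suc m) v
  lift-independence indep c rel = vanishes
    where
      c'≡0 : ∀ j → removeAt c p j ≡ 0ℚ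
      c'≡0 = indep (removeAt c p) (restrict-relation c rel)
      vanishes : ∀ i → c i ≡ 0ℚ
      vanishes i with p ≟ i
      ... | yes refl = pivot-coefficient c rel c'≡0
      ... | no p≢i   = trans (sym (removeAt-punchOut c p≢i)) (c'≡0 (punchOut p≢i))

relation-of-tails : ∀ {n m} (v : Fin m → Vec (suc n)) → (∀ j → v j zero ≡ 0ℚ) →
  ∀ c → IsRelation m c (λ j k → v j (suc k)) → IsRelation m c v
relation-of-tails {m = m} v first≡0 c rel zero    = ∑-zero m (λ j → trans (cong (c j *_) (first≡0 j)) (ℚₚ.*-zeroʳ (c j)))
relation-of-tails         v first≡0 c rel (suc k) = rel k

-- Induction on n: if every first coordinate vanishes,
-- drop it; otherwise eliminate against a pivot.
dependent-or-independent : ∀ n m (v : Fin m → Vec n) → Dependent m v ⊎ (Independent m v × m ℕ.≤ n)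
dependent-or-independent n       zero    v = inj₂ ((λ _ _ ()) , z≤n)
dependent-or-independent zero    (suc m) v = inj₁ ((λ _ → 1ℚ) , (λ ()) , zero , ℚₚ.1≢0)
dependent-or-independent (suc n) (suc m) v with all? (λ j → v j zero ℚₚ.≟ 0ℚ)
... | yes first≡0 =
  Sum.map (λ { (c , rel , nonzero) → c , relation-of-tails v first≡0 c rel , nonzero })
          (Prod.map (λ indep c rel → indep c (rel ∘ suc)) ℕₚ.m≤n⇒m≤1+n)
          (dependent-or-independent n (suc m) (λ j k → v j (suc k)))
... | no ¬first≡0 with ¬∀⟶∃¬ (suc m) _ (λ j → v j zero ℚₚ.≟ 0ℚ) ¬first≡0
...   | p , pivot≢0 =
  Sum.map lift-dependence (Prod.map lift-independence s≤s) (dependent-or-independent n m reduced)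
  where open Pivot v p pivot≢0

dependent-unless-independent : ∀ {n} m (v : Fin m → Vec n) → ¬ Independent m v → Dependent m v
dependent-unless-independent {n} m v ¬indep with dependent-or-independent n m v
... | inj₁ dep          = dep
... | inj₂ (indep , _) = ⊥-elim (¬indep indep)

independent? : ∀ {n} m (v : Fin m → Vec n) → Dec (Independent m v)
independent? {n} m v with dependent-or-independent n m v
... | inj₁ dep          = no (dependent⇒¬independent m v dep)
... | inj₂ (indep , _) = yes indep

-- The
-- coefficient rows are m vectors in ℚᵏ, hence dependent, and a relation
-- among the rows is a relation among the vectors.
exchange : ∀ {n} m k (g : Fin k → Vec n) (w : Fin m → Vec n) →
  (∀ j → InSpan k g (w j)) → k < m → Dependent m w
exchange m k g w spanned k<m with dependent-or-independent k m (proj₁ ∘ spanned)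
... | inj₂ (_ , m≤k)            = ⊥-elim (ℕₚ.<⇒≱ k<m m≤k)
... | inj₁ (c , rel , nonzero) = c , rel-w , nonzero
  where
    M : Fin m → Fin k → ℚ
    M = proj₁ ∘ spanned
    rel-w : IsRelation m c w
    rel-w x = begin
      ∑[ j < m ] (c j * w j x)
        ≡⟨ sum-cong-≗ (λ j → cong (c j *_) (proj₂ (spanned j) x)) ⟩
      ∑[ j < m ] (c j * ∑[ t < k ] (M j t * g t x))
        ≡⟨ sum-cong-≗ (λ j → *-distribˡ-sum (c j) (λ t → M j t * g t x)) ⟩
      ∑[ j < m ] ∑[ t < k ] (c j * (M j t * g t x))
        ≡⟨ ∑-comm (λ j t → c j * (M j t * g t x)) ⟩
      ∑[ t < k ] ∑[ j < m ] (c j * (M j t * g t x))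
        ≡⟨ sum-cong-≗ (λ t → trans (sum-cong-≗ (λ j → sym (ℚₚ.*-assoc (c j) (M j t) (g t x))))
                                   (sym (*-distribʳ-sum (g t x) (λ j → c j * M j t)))) ⟩
      ∑[ t < k ] (∑[ j < m ] (c j * M j t) * g t x)
        ≡⟨ ∑-zero k (λ t → trans (cong (_* g t x) (rel t)) (ℚₚ.*-zeroˡ (g t x))) ⟩
      0ℚ ∎

-- If b is independent but x, b is dependent, then x lies in the span of b:
-- the coefficient of x in the relation cannot vanish.
dependent-extension⇒span : ∀ {n} d (b : Fin d → Vec n) x →
  Independent d b → Dependent (suc d) (cons x b) → InSpan d b x
dependent-extension⇒span d b x indep (c , rel , q , cq≢0) with c zero ℚₚ.≟ 0ℚ
... | yes c₀≡0 = ⊥-elim (cq≢0 (all-zero q))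
  where
    rel-b : IsRelation d (c ∘ suc) b
    rel-b k = begin
      ∑[ t < d ] (c (suc t) * b t k)                 ≡⟨ sym (ℚₚ.+-identityˡ _) ⟩
      0ℚ + ∑[ t < d ] (c (suc t) * b t k)            ≡⟨ cong (_+ _) (sym (trans (cong (_* x k) c₀≡0) (ℚₚ.*-zeroˡ (x k)))) ⟩
      c zero * x k + ∑[ t < d ] (c (suc t) * b t k) ≡⟨ rel k ⟩
      0ℚ                                              ∎
    all-zero : ∀ i → c i ≡ 0ℚ
    all-zero zero    = c₀≡0
    all-zero (suc t) = indep (c ∘ suc) rel-b t
... | no c₀≢0 = (λ t → w * c (suc t)) , coordinates
  where
    instance
      c₀-nonZero : NonZero (c zero)
      c₀-nonZero = ≢-nonZero c₀≢0
    w : ℚ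
    w = - (1/ c zero)
    coordinates : ∀ k → x k ≡ ∑[ t < d ] (w * c (suc t) * b t k)
    coordinates k = sym (begin
      ∑[ t < d ] (w * c (suc t) * b t k)   ≡⟨ sum-cong-≗ (λ t → ℚₚ.*-assoc w (c (suc t)) (b t k)) ⟩
      ∑[ t < d ] (w * (c (suc t) * b t k)) ≡⟨ sym (*-distribˡ-sum w (λ t → c (suc t) * b t k)) ⟩
      w * ∑[ t < d ] (c (suc t) * b t k)   ≡⟨ cong (w *_) (inverseʳ-unique (c zero * x k) _ (rel k)) ⟩
      w * - (c zero * x k)                 ≡⟨ solve 3 (λ i c x → (:- i) :* (:- (c :* x)) := x :* (i :* c)) refl (1/ c zero) (c zero) (x k) ⟩
      x k * (1/ c zero * c zero)           ≡⟨ cong (x k *_) (ℚₚ.*-inverseˡ (c zero)) ⟩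
      x k * 1ℚ                             ≡⟨ ℚₚ.*-identityʳ (x k) ⟩
      x k                                  ∎)

zero∈span : ∀ {n} k (g : Fin k → Vec n) → InSpan k g 0v
zero∈span k g = (λ _ → 0ℚ) , λ i → sym (∑-zero k (λ t → ℚₚ.*-zeroˡ (g t i)))

cone-+ : ∀ {n} m (g : Fin m → Vec n) {x y} → InCone m g x → InCone m g y → InCone m g (x +v y)
cone-+ m g {x} {y} (c , c≥0 , x≈) (c' , c'≥0 , y≈) = (λ j → c j + c' j) , sum≥0 , coords
  where
    sum≥0 : ∀ j → 0ℚ ≤ c j + c' j
    sum≥0 j = subst (_≤ c j + c' j) (ℚₚ.+-identityʳ 0ℚ) (ℚₚ.+-mono-≤ (c≥0 j) (c'≥0 j))
    coords : ∀ k → x k + y k ≡ lincomb m (λ j → c j + c' j) g k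
    coords k = begin
      x k + y k                                              ≡⟨ cong₂ _+_ (trans (x≈ k) (lincomb-coord m c g k)) (trans (y≈ k) (lincomb-coord m c' g k)) ⟩
      ∑[ j < m ] (c j * g j k) + ∑[ j < m ] (c' j * g j k)  ≡⟨ sym (∑-distrib-+ (λ j → c j * g j k) (λ j → c' j * g j k)) ⟩
      ∑[ j < m ] (c j * g j k + c' j * g j k)               ≡⟨ sum-cong-≗ (λ j → sym (ℚₚ.*-distribʳ-+ (g j k) (c j) (c' j))) ⟩
      ∑[ j < m ] ((c j + c' j) * g j k)                      ≡⟨ sym (lincomb-coord m _ g k) ⟩
      lincomb m (λ j → c j + c' j) g k                       ∎

-- In a set C closed under addition with an extremal ray ρ, if u + w = 0 with
-- u, w ∈ C, then w is a nonnegative multiple of ρ: write ρ = (ρ + u) + w.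
absorbed-by-ray : ∀ {n} (C : Vec n → Set) → (∀ {x y} → C x → C y → C (x +v y)) →
  ∀ {ρ} → IsExtremalRay C ρ → ∀ {u w} → C u → C w → (u +v w) ≈ 0v →
  Σ ℚ λ β → (0ℚ ≤ β) × (w ≈ (β · ρ))
absorbed-by-ray C closed {ρ} (ρ∈C , _ , split) {u} {w} u∈C w∈C u+w≈0 =
  proj₂ (split (ρ +v u) w (closed ρ∈C u∈C) w∈C sums-to-ρ)
  where
    sums-to-ρ : ((ρ +v u) +v w) ≈ ρ
    sums-to-ρ k = trans (ℚₚ.+-assoc (ρ k) (u k) (w k)) (trans (cong (ρ k +_) (u+w≈0 k)) (ℚₚ.+-identityʳ (ρ k)))

-- A cone generated by extremal rays is pointed: x + y = 0 inside it forces
-- x = 0.  Both x and y are nonnegative multiples β'·r₀, β·r₀ of the first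
-- generator, and (β + β')·r₀ = 0 with r₀ ≠ 0 gives β + β' = 0.
pointed : ∀ {n} l (r : Fin l → Vec n) → (∀ i → IsExtremalRay (InCone l r) (r i)) →
  ∀ {x y} → InCone l r x → InCone l r y → (x +v y) ≈ 0v → x ≈ 0v
pointed zero    r ext (_ , _ , x≈0) _ _ = x≈0
pointed {n} (suc l) r ext {x} {y} x∈C y∈C x+y≈0 k = begin
  x k          ≡⟨ proj₂ (proj₂ x-multiple) k ⟩
  β' * r₀ k    ≡⟨ cong (_* r₀ k) β'≡0 ⟩
  0ℚ * r₀ k    ≡⟨ ℚₚ.*-zeroˡ (r₀ k) ⟩
  0ℚ           ∎
  where
    r₀ : Vec n
    r₀ = r zero
    absorbed : ∀ {u w} → InCone (suc l) r u → InCone (suc l) r w → (u +v w) ≈ 0v →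
      Σ ℚ λ β → (0ℚ ≤ β) × (w ≈ (β · r₀))
    absorbed = absorbed-by-ray (InCone (suc l) r) (cone-+ (suc l) r) (ext zero)
    y-multiple : Σ ℚ λ β → (0ℚ ≤ β) × (y ≈ (β · r₀))
    y-multiple = absorbed x∈C y∈C x+y≈0
    x-multiple : Σ ℚ λ β → (0ℚ ≤ β) × (x ≈ (β · r₀))
    x-multiple = absorbed y∈C x∈C (λ k → trans (ℚₚ.+-comm (y k) (x k)) (x+y≈0 k))
    β β' : ℚ
    β  = proj₁ y-multiple
    β' = proj₁ x-multiple
    annihilates : ∀ k → (β' + β) * r₀ k ≡ 0ℚ
    annihilates k = trans (ℚₚ.*-distribʳ-+ (r₀ k) β' β)
      (trans (cong₂ _+_ (sym (proj₂ (proj₂ x-multiple) k)) (sym (proj₂ (proj₂ y-multiple) k))) (x+y≈0 k))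
    β'≡0 : β' ≡ 0ℚ
    β'≡0 = nonneg-sum-zero (proj₁ (proj₂ x-multiple)) (proj₁ (proj₂ y-multiple))
             (scalar-annihilates (β' + β) r₀ annihilates (proj₁ (proj₂ (ext zero))))

unit∈R : ∀ {n} (A : Subset n) (i : Fin n) → InR A (e i)
unit∈R A i = inj₂ (inj₁ (i , λ _ → refl))

-- The extended cone C' = cone(E, r₁,…,r_l) for a unit vector E outside the
-- span of a maximal independent family b ⊆ C.
module ExtendedCone {n l : ℕ} (r : Fin l → Vec n) (ext : ∀ i → IsExtremalRay (InCone l r) (r i))
                    {d : ℕ} (dim : HasDim (InCone l r) d) (d<n : d < n) where

  C : Vec n → Set
  C = InCone l r

  basis : Fin d → Vec n
  basis = proj₁ (proj₁ dim)

  basis∈C : ∀ t → C (basis t)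
  basis∈C = proj₁ (proj₂ (proj₁ dim))

  basis-independent : Independent d basis
  basis-independent = LinIndep⇒independent d basis (proj₂ (proj₂ (proj₁ dim)))

  -- By maximality of the basis, C lies in its span.
  cone⊆span : ∀ {x} → C x → InSpan d basis x
  cone⊆span {x} x∈C = dependent-extension⇒span d basis x basis-independent
    (dependent-unless-independent (suc d) (cons x basis) (proj₂ dim (cons x basis) members ∘ independent⇒LinIndep (suc d) (cons x basis)))
    where
      members : ∀ t → C (cons x basis t)
      members zero    = x∈C
      members (suc t) = basis∈C t

  -- Since d < n, some unit vector extends the basis to an independent family:
  -- otherwise all n unit vectors lie in the span of d vectors.
  new-direction : Σ (Fin n) λ i → Independent (suc d) (cons (e i) basis)
  new-direction with any? (λ i → independent? (suc d) (cons (e i) basis))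
  ... | yes found = found
  ... | no none   = ⊥-elim (dependent⇒¬independent n e (exchange n d basis e units∈span d<n) (units-independent n))
    where
      units∈span : ∀ i → InSpan d basis (e i)
      units∈span i = dependent-extension⇒span d basis (e i) basis-independent
        (dependent-unless-independent (suc d) (cons (e i) basis) (λ indep → none (i , indep)))

  E : Vec n
  E = e (proj₁ new-direction)

  extended-independent : Independent (suc d) (cons E basis)
  extended-independent = proj₂ new-direction

  C' : Vec n → Set
  C' = InCone (suc l) (cons E r)

  record Decomposition (w : Vec n) : Set where
    field
      coeff   : ℚ
      coeff≥0 : 0ℚ ≤ coeff
      rest    : Vec n
      rest∈C  : C rest
      splits  : ∀ k → w k ≡ coeff * E k + rest k
  open Decomposition

  decompose : ∀ {w} → C' w → Decomposition w
  decompose (c , c≥0 , w≈) = record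
    { coeff = c zero ; coeff≥0 = c≥0 zero
    ; rest = lincomb l (c ∘ suc) r ; rest∈C = (c ∘ suc , c≥0 ∘ suc , λ _ → refl)
    ; splits = w≈ }

  C⊆C' : ∀ {x} → C x → C' x
  C⊆C' {x} (c , c≥0 , x≈) = 0ℚ ∷ c , coeffs≥0 , λ k → trans (x≈ k) (sym (no-E k))
    where
      coeffs≥0 : ∀ j → 0ℚ ≤ (0ℚ ∷ c) j
      coeffs≥0 zero    = ℚₚ.≤-refl
      coeffs≥0 (suc j) = c≥0 j
      no-E : ∀ k → 0ℚ * E k + lincomb l c r k ≡ lincomb l c r k
      no-E k = trans (cong (_+ lincomb l c r k) (ℚₚ.*-zeroˡ (E k))) (ℚₚ.+-identityˡ _)

  E∈C' : C' E
  E∈C' = 1ℚ ∷ (λ _ → 0ℚ) , coeffs≥0 , λ k → sym (only-E k)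
    where
      coeffs≥0 : ∀ j → 0ℚ ≤ (1ℚ ∷ (λ _ → 0ℚ)) j
      coeffs≥0 zero    = ℚₚ.nonNegative⁻¹ 1ℚ
      coeffs≥0 (suc j) = ℚₚ.≤-refl
      only-E : ∀ k → 1ℚ * E k + lincomb l (λ _ → 0ℚ) r k ≡ E k
      only-E k = begin
        1ℚ * E k + lincomb l (λ _ → 0ℚ) r k ≡⟨ cong (1ℚ * E k +_) (lincomb-coord l _ r k) ⟩
        1ℚ * E k + ∑[ j < l ] (0ℚ * r j k)  ≡⟨ cong (1ℚ * E k +_) (∑-zero l (λ j → ℚₚ.*-zeroˡ (r j k))) ⟩
        1ℚ * E k + 0ℚ                        ≡⟨ ℚₚ.+-identityʳ _ ⟩
        1ℚ * E k                             ≡⟨ ℚₚ.*-identityˡ (E k) ⟩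
        E k                                  ∎

  coordinates-unique : ∀ {a a' x x'} → InSpan d basis x → InSpan d basis x' →
    (∀ k → a * E k + x k ≡ a' * E k + x' k) → (a ≡ a') × (x ≈ x')
  coordinates-unique {a} {a'} {x} {x'} (β , x≈) (β' , x'≈) same =
    x∙y⁻¹≈ε⇒x≈y a a' (vanish zero) , λ k → begin
      x k                        ≡⟨ x≈ k ⟩
      ∑[ t < d ] (β t * b t k)   ≡⟨ sum-cong-≗ (λ t → cong (_* b t k) (x∙y⁻¹≈ε⇒x≈y (β t) (β' t) (vanish (suc t)))) ⟩
      ∑[ t < d ] (β' t * b t k)  ≡⟨ sym (x'≈ k) ⟩
      x' k                       ∎
    where
      b : Fin d → Vec n
      b = basis
      difference : Fin (suc d) → ℚ
      difference = (a - a') ∷ (λ t → β t - β' t)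
      rel : IsRelation (suc d) difference (cons E basis)
      rel k = begin
        (a - a') * E k + ∑[ t < d ] ((β t - β' t) * b t k)
          ≡⟨ cong ((a - a') * E k +_) (trans (sum-cong-≗ (λ t → solve 3 (λ p q y → (p :- q) :* y := p :* y :- q :* y) refl (β t) (β' t) (b t k)))
                                             (∑-sub d _ _)) ⟩
        (a - a') * E k + (∑[ t < d ] (β t * b t k) - ∑[ t < d ] (β' t * b t k))
          ≡⟨ solve 5 (λ a a' y s s' → (a :- a') :* y :+ (s :- s') := (a :* y :+ s) :- (a' :* y :+ s')) refl a a' (E k) _ _ ⟩
        (a * E k + ∑[ t < d ] (β t * b t k)) - (a' * E k + ∑[ t < d ] (β' t * b t k))
          ≡⟨ cong₂ (λ u u' → (a * E k + u) - (a' * E k + u')) (sym (x≈ k)) (sym (x'≈ k)) ⟩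
        (a * E k + x k) - (a' * E k + x' k)
          ≡⟨ cong (_- (a' * E k + x' k)) (same k) ⟩
        (a' * E k + x' k) - (a' * E k + x' k)
          ≡⟨ ℚₚ.+-inverseʳ (a' * E k + x' k) ⟩
        0ℚ ∎
      vanish : ∀ i → difference i ≡ 0ℚ
      vanish = extended-independent difference rel

  split-sum : ∀ {x y α w} (dx : Decomposition x) (dy : Decomposition y) → InSpan d basis w →
    (∀ k → x k + y k ≡ α * E k + w k) → (coeff dx + coeff dy ≡ α) × ((rest dx +v rest dy) ≈ w)
  split-sum {x} {y} {α} {w} dx dy w∈span x+y≡ =
    coordinates-unique (cone⊆span (cone-+ l r (rest∈C dx) (rest∈C dy))) w∈span regrouped
    where
      regrouped : ∀ k → (coeff dx + coeff dy) * E k + (rest dx k + rest dy k) ≡ α * E k + w k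
      regrouped k = begin
        (coeff dx + coeff dy) * E k + (rest dx k + rest dy k)
          ≡⟨ solve 5 (λ a a' y u u' → (a :+ a') :* y :+ (u :+ u') := (a :* y :+ u) :+ (a' :* y :+ u')) refl (coeff dx) (coeff dy) (E k) (rest dx k) (rest dy k) ⟩
        (coeff dx * E k + rest dx k) + (coeff dy * E k + rest dy k)
          ≡⟨ cong₂ _+_ (sym (splits dx k)) (sym (splits dy k)) ⟩
        x k + y k
          ≡⟨ x+y≡ k ⟩
        α * E k + w k ∎

  lower-bound : Σ (Fin (suc d) → Vec n) λ v → (∀ j → C' (v j)) × LinIndep (suc d) v
  lower-bound = cons E basis , members , independent⇒LinIndep (suc d) (cons E basis) extended-independent
    where
      members : ∀ j → C' (cons E basis j)
      members zero    = E∈C'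
      members (suc t) = C⊆C' (basis∈C t)

  -- C' lies in the span of the d + 1 vectors E, basis, so d + 2 of its
  -- vectors are dependent.
  upper-bound : ∀ (w : Fin (suc (suc d)) → Vec n) → (∀ j → C' (w j)) → ¬ LinIndep (suc (suc d)) w
  upper-bound w w∈C' =
    dependent⇒¬independent _ w (exchange _ (suc d) (cons E basis) w spanned (ℕₚ.n<1+n (suc d)))
    ∘ LinIndep⇒independent _ w
    where
      spanned : ∀ j → InSpan (suc d) (cons E basis) (w j)
      spanned j = coeff dw ∷ proj₁ rest-span , λ k → trans (splits dw k) (cong (coeff dw * E k +_) (proj₂ rest-span k))
        where
          dw : Decomposition (w j)
          dw = decompose (w∈C' j)
          rest-span : InSpan d basis (rest dw)
          rest-span = cone⊆span (rest∈C dw)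

  dimension : HasDim C' (suc d)
  dimension = lower-bound , upper-bound

  -- Both summands of a decomposition of E have zero C-part (by pointedness),
  -- so they are multiples of E.
  E-extremal : IsExtremalRay C' E
  E-extremal = E∈C' , E≢0 , split
    where
      E≢0 : ¬ (E ≈ 0v)
      E≢0 E≈0 = ℚₚ.1≢0 (trans (sym (unit-diagonal (proj₁ new-direction))) (E≈0 (proj₁ new-direction)))
      multiple-of-E : ∀ {x} (dx : Decomposition x) → rest dx ≈ 0v → Σ ℚ λ a → (0ℚ ≤ a) × (x ≈ (a · E))
      multiple-of-E dx rest≈0 = coeff dx , coeff≥0 dx , λ k →
        trans (splits dx k) (trans (cong (coeff dx * E k +_) (rest≈0 k)) (ℚₚ.+-identityʳ _))
      split : ∀ x y → C' x → C' y → (x +v y) ≈ E →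
        (Σ ℚ λ a → (0ℚ ≤ a) × (x ≈ (a · E))) × (Σ ℚ λ b → (0ℚ ≤ b) × (y ≈ (b · E)))
      split x y x∈C' y∈C' x+y≈E = multiple-of-E dx rest-x≈0 , multiple-of-E dy rest-y≈0
        where
          dx : Decomposition x
          dx = decompose x∈C'
          dy : Decomposition y
          dy = decompose y∈C'
          E-as-sum : ∀ k → x k + y k ≡ 1ℚ * E k + 0v k
          E-as-sum k = trans (x+y≈E k) (sym (trans (ℚₚ.+-identityʳ _) (ℚₚ.*-identityˡ (E k))))
          rests≈0 : (rest dx +v rest dy) ≈ 0v
          rests≈0 = proj₂ (split-sum {α = 1ℚ} dx dy (zero∈span d basis) E-as-sum)
          rest-x≈0 : rest dx ≈ 0v
          rest-x≈0 = pointed l r ext (rest∈C dx) (rest∈C dy) rests≈0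
          rest-y≈0 : rest dy ≈ 0v
          rest-y≈0 = pointed l r ext (rest∈C dy) (rest∈C dx) (λ k → trans (ℚₚ.+-comm (rest dy k) (rest dx k)) (rests≈0 k))

  -- In a decomposition of r_j the E-coefficients vanish (they are nonnegative
  -- with zero sum), so the summands lie in C and extremality in C applies.
  r-extremal : ∀ j → IsExtremalRay C' (r j)
  r-extremal j = C⊆C' rj∈C , rj≢0 , split
    where
      rj∈C : C (r j)
      rj∈C = proj₁ (ext j)
      rj≢0 : ¬ (r j ≈ 0v)
      rj≢0 = proj₁ (proj₂ (ext j))
      extremal-in-C : ∀ x y → C x → C y → (x +v y) ≈ r j →
        (Σ ℚ λ a → (0ℚ ≤ a) × (x ≈ (a · r j))) × (Σ ℚ λ b → (0ℚ ≤ b) × (y ≈ (b · r j)))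
      extremal-in-C = proj₂ (proj₂ (ext j))
      in-C : ∀ {x} (dx : Decomposition x) → coeff dx ≡ 0ℚ → x ≈ rest dx
      in-C {x} dx coeff≡0 k = begin
        x k                          ≡⟨ splits dx k ⟩
        coeff dx * E k + rest dx k   ≡⟨ cong (λ a → a * E k + rest dx k) coeff≡0 ⟩
        0ℚ * E k + rest dx k         ≡⟨ cong (_+ rest dx k) (ℚₚ.*-zeroˡ (E k)) ⟩
        0ℚ + rest dx k               ≡⟨ ℚₚ.+-identityˡ _ ⟩
        rest dx k                    ∎
      split : ∀ x y → C' x → C' y → (x +v y) ≈ r j →
        (Σ ℚ λ a → (0ℚ ≤ a) × (x ≈ (a · r j))) × (Σ ℚ λ b → (0ℚ ≤ b) × (y ≈ (b · r j)))
      split x y x∈C' y∈C' x+y≈rj =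
        Prod.map (Prod.map₂ (Prod.map₂ (λ eq k → trans (x≈rest k) (eq k))))
                 (Prod.map₂ (Prod.map₂ (λ eq k → trans (y≈rest k) (eq k))))
                 (extremal-in-C (rest dx) (rest dy) (rest∈C dx) (rest∈C dy) rests≈rj)
        where
          dx : Decomposition x
          dx = decompose x∈C'
          dy : Decomposition y
          dy = decompose y∈C'
          rj-as-sum : ∀ k → x k + y k ≡ 0ℚ * E k + r j k
          rj-as-sum k = trans (x+y≈rj k) (sym (trans (cong (_+ r j k) (ℚₚ.*-zeroˡ (E k))) (ℚₚ.+-identityˡ _)))
          parts : (coeff dx + coeff dy ≡ 0ℚ) × ((rest dx +v rest dy) ≈ r j)
          parts = split-sum dx dy (cone⊆span rj∈C) rj-as-sum
          rests≈rj : (rest dx +v rest dy) ≈ r j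
          rests≈rj = proj₂ parts
          x≈rest : x ≈ rest dx
          x≈rest = in-C dx (nonneg-sum-zero (coeff≥0 dx) (coeff≥0 dy) (proj₁ parts))
          y≈rest : y ≈ rest dy
          y≈rest = in-C dy (nonneg-sum-zero (coeff≥0 dy) (coeff≥0 dx) (trans (ℚₚ.+-comm (coeff dy) (coeff dx)) (proj₁ parts)))

lemma2p5 : (n : ℕ) (A : Subset n) (l : ℕ) (r : Fin l → Vec n)
    → (∀ i j → r i ≈ r j → i ≡ j)
    → (∀ i → InR A (r i))
    → (∀ i → IsExtremalRay (InCone l r) (r i))
    → (d : ℕ) → HasDim (InCone l r) d → d < n
    → Σ (Vec n) λ r̃ → InR A r̃
        × HasDim (InCone (suc l) (cons r̃ r)) (suc d)
        × (∀ (i : Fin (suc l)) → IsExtremalRay (InCone (suc l) (cons r̃ r)) (cons r̃ r i))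
lemma2p5 n A l r _ _ ext d dim d<n = E , unit∈R A (proj₁ new-direction) , dimension , extremal
  where
    open ExtendedCone r ext dim d<n
    extremal : ∀ (i : Fin (suc l)) → IsExtremalRay C' (cons E r i)
    extremal zero    = E-extremal
    extremal (suc j) = r-extremal j
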